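{- Let $\Gamma$ be a basis, $M$ a $CL$-term and $\sigma$ a simple type. If $\Gamma\models M:\sigma$, then $\Gamma\vdash_{CL^=}M:\sigma$.
   Context: $CL$-terms: $M,N ::= x \mid \mathsf{S} \mid \mathsf{K} \mid \mathsf{I} \mid MN$ over a countable set $V$ of term variables. The equational theory $\mathcal{EQ}^\eta$ has axioms $M=M$, $\mathsf S MNL=(ML)(NL)$, $\mathsf K MN=M$, $\mathsf I M=M$ and rules: symmetry, transitivity, from $M=N$ infer $MP=NP$ and $PM=PN$, and from $Mx=Nx$ with $x$ not occurring in $M$ or $N$ infer $M=N$. Simple types $\sigma ::= a\mid\sigma\to\tau$ (set ${\sf Types}$). A basis is a set of declarations $x:\sigma$ with pairwise distinct variables. The system $CL_\rightarrow^=$ derives $\Gamma\vdash_{CL^=}M:\sigma$ by: $x:\sigma$ if $x:\sigma\in\Gamma$; $\mathsf S:(\sigma\to(\rho\to\tau))\to((\sigma\to\rho)\to(\sigma\to\tau))$; $\mathsf K:\sigma\to(\tau\to\sigma)$; $\mathsf I:\sigma\to\sigma$ (all types); from $M:\sigma\to\tau$ and $N:\sigma$ infer $MN:\tau$; and (eq): from $\Gamma\vdash_{CL^=}M:\sigma$ and $M=N$ provable in $\mathcal{EQ}^\eta$ infer $\Gamma\vdash_{CL^=}N:\sigma$. An applicative structure for $LCL$ is $\langle D,\{A^\sigma\}_{\sigma\in{\sf Types}},\cdot,\mathbf s,\mathbf k,\mathbf i\rangle$ with $D$ nonempty, $A^\sigma\subseteq D$, $\cdot:D\times D\to D$ extensional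 (if $d_1\cdot e=d_2\cdot e$ for all $e$ then $d_1=d_2$) and mapping $A^{\sigma\to\tau}\times A^\sigma$ into $A^\tau$; $\mathbf s\in A^{(\sigma\to(\tau\to\rho))\to((\sigma\to\tau)\to(\sigma\to\rho))}$ for all $\sigma,\tau,\rho$ with $((\mathbf s\cdot d)\cdot e)\cdot f=(d\cdot f)\cdot(e\cdot f)$; $\mathbf k\in A^{\sigma\to(\tau\to\sigma)}$ for all $\sigma,\tau$ with $(\mathbf k\cdot d)\cdot e=d$; $\mathbf i\in A^{\sigma\to\sigma}$ for all $\sigma$ with $\mathbf i\cdot d=d$. An $LCL$-model $\mathcal M_\rho$ is such a structure with an environment $\rho:V\to D$. Interpretation: $[\![x]\!]_\rho=\rho(x)$, $[\![\mathsf S]\!]_\rho=\mathbf s$, $[\![\mathsf K]\!]_\rho=\mathbf k$, $[\![\mathsf I]\!]_\rho=\mathbf i$, $[\![MN]\!]_\rho=[\![M]\!]_\rho\cdot[\![N]\!]_\rho$. $\mathcal M_\rho\models M:\sigma$ iff $[\![M]\!]_\rho\in A^\sigma$. $\Gamma\models M:\sigma$ means every $LCL$-model satisfying all declarations in $\Gamma$ satisfies $M:\sigma$. -}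

module Defs where

open import Data.Nat using (ℕ)
open import Relation.Binary.PropositionalEquality using (_≡_)
open import Relation.Binary.Structures using (IsEquivalence)
open import Relation.Nullary using (¬_)
open import Data.Product using (_×_)

infixr 20 _⇒_
infixl 30 _·_

data Type : Set where
  atom : ℕ → Type
  _⇒_  : Type → Type → Type

data Term : Set where
  var : ℕ → Term
  S K I : Term
  _·_ : Term → Term → Term

data _occursIn_ (x : ℕ) : Term → Set where
  here  : x occursIn var x
  left  : ∀ {M N} → x occursIn M → x occursIn (M · N)
  right : ∀ {M N} → x occursIn N → x occursIn (M · N)

infix 4 _≐_
data _≐_ : Term → Term → Set where
  refl≐  : ∀ {M} → M ≐ M
  axS    : ∀ {M N L} → S · M · N · L ≐ (M · L) · (N · L)
  axK    : ∀ {M N} → K · M · N ≐ M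
  axI    : ∀ {M} → I · M ≐ M
  sym≐   : ∀ {M N} → M ≐ N → N ≐ M
  trans≐ : ∀ {M N L} → M ≐ N → N ≐ L → M ≐ L
  appL   : ∀ {M N} P → M ≐ N → M · P ≐ N · P
  appR   : ∀ {M N} P → M ≐ N → P · M ≐ P · N
  ext    : ∀ {M N} x → ¬ (x occursIn M) → ¬ (x occursIn N) →
           M · var x ≐ N · var x → M ≐ N

record Basis : Set₁ where
  field
    _∶_∈Γ    : ℕ → Type → Set
    distinct : ∀ {x σ τ} → x ∶ σ ∈Γ → x ∶ τ ∈Γ → σ ≡ τ
open Basis public

infix 3 _⊢_∶_
data _⊢_∶_ (Γ : Basis) : Term → Type → Set where
  tvar : ∀ {x σ} → (Γ ∶ x ∈Γ) σ → Γ ⊢ var x ∶ σ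
  tS   : ∀ {σ ρ τ} → Γ ⊢ S ∶ (σ ⇒ (ρ ⇒ τ)) ⇒ ((σ ⇒ ρ) ⇒ (σ ⇒ τ))
  tK   : ∀ {σ τ} → Γ ⊢ K ∶ σ ⇒ (τ ⇒ σ)
  tI   : ∀ {σ} → Γ ⊢ I ∶ σ ⇒ σ
  tapp : ∀ {M N σ τ} → Γ ⊢ M ∶ σ ⇒ τ → Γ ⊢ N ∶ σ → Γ ⊢ M · N ∶ τ
  teq  : ∀ {M N σ} → Γ ⊢ M ∶ σ → M ≐ N → Γ ⊢ N ∶ σ

-- Applicative structures for LCL (carrier equality given as a setoid equality _≈_)
record ApplicativeStructure : Set₁ where
  infixl 30 _∙_
  infix 4 _≈_
  field
    D      : Set
    _≈_    : D → D → Set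
    isEquivalence : IsEquivalence _≈_
    point  : D                                  -- D nonempty
    A      : Type → D → Set
    A-resp : ∀ {σ d e} → d ≈ e → A σ d → A σ e
    _∙_    : D → D → D
    ∙-cong : ∀ {d d' e e'} → d ≈ d' → e ≈ e' → (d ∙ e) ≈ (d' ∙ e')
    extensional : ∀ {d₁ d₂} → (∀ e → (d₁ ∙ e) ≈ (d₂ ∙ e)) → d₁ ≈ d₂
    ∙-A    : ∀ {σ τ d e} → A (σ ⇒ τ) d → A σ e → A τ (d ∙ e)
    s k i  : D
    s-A    : ∀ {σ τ ρ} → A ((σ ⇒ (τ ⇒ ρ)) ⇒ ((σ ⇒ τ) ⇒ (σ ⇒ ρ))) s
    s-eq   : ∀ d e f → ((s ∙ d) ∙ e) ∙ f ≈ (d ∙ f) ∙ (e ∙ f)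
    k-A    : ∀ {σ τ} → A (σ ⇒ (τ ⇒ σ)) k
    k-eq   : ∀ d e → (k ∙ d) ∙ e ≈ d
    i-A    : ∀ {σ} → A (σ ⇒ σ) i
    i-eq   : ∀ d → i ∙ d ≈ d

record LCLModel : Set₁ where
  field
    structure : ApplicativeStructure
  open ApplicativeStructure structure public
  field
    env : ℕ → D

module _ (𝓜 : LCLModel) where
  open LCLModel 𝓜
  ⟦_⟧ : Term → D
  ⟦ var x ⟧ = env x
  ⟦ S ⟧ = s
  ⟦ K ⟧ = k
  ⟦ I ⟧ = i
  ⟦ M · N ⟧ = ⟦ M ⟧ ∙ ⟦ N ⟧

  satisfies : Term → Type → Set
  satisfies M σ = A σ ⟦ M ⟧

infix 3 _⊨_∶_
_⊨_∶_ : Basis → Term → Type → Set₁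
Γ ⊨ M ∶ σ = (𝓜 : LCLModel) →
  (∀ {x τ} → (Γ ∶ x ∈Γ) τ → satisfies 𝓜 (var x) τ) → satisfies 𝓜 M σ

-- Completeness via the term model: take CL-terms modulo EQ^η as carrier and let
-- A^σ be the set of terms typable with σ in Γ. Rule (eq) makes A^σ closed under
-- equality, the η-rule makes application extensional, and the typing axioms for
-- S, K, I are exactly the membership conditions on s, k, i. With the identity
-- environment every term denotes itself and every declaration of Γ holds, so
-- Γ ⊨ M : σ applied to this model yields Γ ⊢ M : σ.
module Submission where

open import Defs
open import Data.Nat using (ℕ; suc; _⊔_; _≤_)
open import Data.Nat.Properties using (≤-refl; ≤-trans; m≤m⊔n; m≤n⊔m; n≮n)
open import Relation.Binary.PropositionalEquality using (_≡_; refl; cong₂; subst)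
open import Relation.Nullary using (¬_)

maxVar : Term → ℕ
maxVar (var x) = x
maxVar S = 0
maxVar K = 0
maxVar I = 0
maxVar (M · N) = maxVar M ⊔ maxVar N

occursIn⇒≤maxVar : ∀ {x M} → x occursIn M → x ≤ maxVar M
occursIn⇒≤maxVar here = ≤-refl
occursIn⇒≤maxVar {M = M · N} (left p) =
  ≤-trans (occursIn⇒≤maxVar p) (m≤m⊔n (maxVar M) (maxVar N))
occursIn⇒≤maxVar {M = M · N} (right p) =
  ≤-trans (occursIn⇒≤maxVar p) (m≤n⊔m (maxVar M) (maxVar N))

fresh : Term → ℕ
fresh M = suc (maxVar M)

fresh-notOccursIn : ∀ M → ¬ (fresh M occursIn M)
fresh-notOccursIn M p = n≮n (maxVar M) (occursIn⇒≤maxVar p)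

≐-ext : ∀ {M N} → (∀ P → M · P ≐ N · P) → M ≐ N
≐-ext {M} {N} h =
  ext x (λ p → fresh-notOccursIn (M · N) (left p))
        (λ p → fresh-notOccursIn (M · N) (right p))
        (h (var x))
  where x = fresh (M · N)

·-cong≐ : ∀ {M M′ N N′} → M ≐ M′ → N ≐ N′ → M · N ≐ M′ · N′
·-cong≐ {M′ = M′} {N = N} p q = trans≐ (appL N p) (appR M′ q)

termStructure : Basis → ApplicativeStructure
termStructure Γ = record
  { D = Term
  ; _≈_ = _≐_
  ; isEquivalence = record { refl = refl≐ ; sym = sym≐ ; trans = trans≐ }
  ; point = I
  ; A = λ σ M → Γ ⊢ M ∶ σ
  ; A-resp = λ M≐N ⊢M → teq ⊢M M≐N
  ; _∙_ = _·_
  ; ∙-cong = ·-cong≐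
  ; extensional = ≐-ext
  ; ∙-A = tapp
  ; s = S ; k = K ; i = I
  ; s-A = tS
  ; s-eq = λ _ _ _ → axS
  ; k-A = tK
  ; k-eq = λ _ _ → axK
  ; i-A = tI
  ; i-eq = λ _ → axI
  }

termModel : Basis → LCLModel
termModel Γ = record { structure = termStructure Γ ; env = var }

⟦⟧-termModel : ∀ Γ M → ⟦ termModel Γ ⟧ M ≡ M
⟦⟧-termModel Γ (var x) = refl
⟦⟧-termModel Γ S = refl
⟦⟧-termModel Γ K = refl
⟦⟧-termModel Γ I = refl
⟦⟧-termModel Γ (M · N) = cong₂ _·_ (⟦⟧-termModel Γ M) (⟦⟧-termModel Γ N)

mainTheorem18 : (Γ : Basis) (M : Term) (σ : Type) → Γ ⊨ M ∶ σ → Γ ⊢ M ∶ σ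
mainTheorem18 Γ M σ Γ⊨M =
  subst (λ N → Γ ⊢ N ∶ σ) (⟦⟧-termModel Γ M) (Γ⊨M (termModel Γ) tvar)
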